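{- Let $n,k$ be positive integers with $s^{n,k}=\frac{n(n+1)}{2k}$ an integer, and let $\mathcal P=[p_1,\ldots,p_k]$ be an ascending partition of $n$ of size $k$. If $\mathrm{slack}(\mathcal P)<0$, then there is an index $j<k$ such that $p_j<p_{j+1}$ and $\mathrm{slack}(\mathcal P)=\mathrm{slack}_j(\mathcal P)$.
   Context: An ascending partition of $n$ of size $k$ is a sequence of positive integers $p_1\le\cdots\le p_k$ with $\sum_i p_i=n$. For $j=1,\ldots,k$, $\mathrm{slack}_j(\mathcal P)=\sum_{i=1}^{p_1+\cdots+p_j}(n-i+1)-j\,s^{n,k}$, and $\mathrm{slack}(\mathcal P)=\min_{1\le j\le k-1}\mathrm{slack}_j(\mathcal P)$. -}

module Defs where

open import Data.Nat as ℕ using (ℕ; zero; suc; _+_; _*_; _∸_; _≤_; _<_)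
open import Data.Integer as ℤ using (ℤ; +_; _-_)
open import Data.List using (List; []; _∷_; take; length)
open import Data.Nat.ListAction using (sum)
open import Data.List.Relation.Unary.All using (All)
open import Data.List.Relation.Unary.Linked using (Linked)
open import Relation.Binary.PropositionalEquality using (_≡_)

record IsAscPartition (n k : ℕ) (ps : List ℕ) : Set where
  field
    size      : length ps ≡ k
    positive  : All (λ p → 1 ≤ p) ps
    ascending : Linked _≤_ ps
    total     : sum ps ≡ n

-- T n m = Σ_{i=1}^{m} (n - i + 1)  (natural-number subtraction; all terms are
-- nonnegative whenever m ≤ n + 1, which is the case in use since m ≤ n).
T : ℕ → ℕ → ℕ
T n zero    = 0
T n (suc m) = T n m + (n ∸ m)

-- p_j for 1-indexed j (pⱼ = element at 0-based position j-1); default 0 out of range.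
p : List ℕ → ℕ → ℕ
p []       _             = 0
p (x ∷ xs) zero          = 0
p (x ∷ xs) (suc zero)    = x
p (x ∷ xs) (suc (suc j)) = p xs (suc j)

slackAt : (n s : ℕ) → List ℕ → ℕ → ℤ
slackAt n s ps j = + T n (sum (take j ps)) - + (j * s)

-- slack(P) = min_{1 ≤ j ≤ k-1} slack_j(P); defined for k ≥ 2 via
-- slackFrom n s ps m j = min_{j ≤ j' ≤ j + m} slack_{j'}(P).
slackFrom : (n s : ℕ) → List ℕ → (m j : ℕ) → ℤ
slackFrom n s ps zero    j = slackAt n s ps j
slackFrom n s ps (suc m) j = slackAt n s ps j ℤ.⊓ slackFrom n s ps m (suc j)

slack : (n s : ℕ) → List ℕ → (k : ℕ) → ℤ
slack n s ps k = slackFrom n s ps (k ∸ 2) 1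

{-# OPTIONS --safe #-}
module Submission where

open import Defs
open import Data.Nat using (ℕ; _+_; _*_; _≤_; _<_)
open import Data.Integer using (+_) renaming (_<_ to _<ℤ_)
open import Data.List using (List)
open import Data.Product using (Σ; _×_)
open import Relation.Binary.PropositionalEquality using (_≡_)

open import Data.Nat using (zero; suc; _∸_; z≤n; s≤s; _<?_)
open import Data.Nat.Properties
import Data.Integer as ℤ
import Data.Integer.Properties as ℤ
open import Data.List using ([]; _∷_; take; drop; length)
open import Data.List.Properties using (take-all; take++drop≡id)
open import Data.List.Relation.Unary.All using (All; _∷_)
open import Data.List.Relation.Unary.Linked using (Linked; [-]; _∷_)
open import Data.Nat.ListAction using (sum)
open import Data.Nat.ListAction.Properties using (sum-++)
open import Data.Product using (_,_; ∃-syntax)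
open import Data.Sum using (inj₁; inj₂)
open import Data.Empty using (⊥; ⊥-elim)
open import Relation.Nullary using (yes; no)
open import Relation.Binary.PropositionalEquality
  using (refl; sym; trans; cong; cong₂; subst; subst₂; module ≡-Reasoning)
open import Data.Nat.Tactic.RingSolver using (solve-∀)
import Data.Integer.Tactic.RingSolver as ℤ-Solver

-- 2·T(m) + m² = m(2n+1) is linear in m, so T(a) + T(a+2q) + q² = 2·T(a+q).  Hence
-- slackⱼ₋₁ + slackⱼ₊₁ + q² = 2·slackⱼ whenever pⱼ = pⱼ₊₁ = q ≥ 1, and then slackⱼ cannot
-- lie below both of its neighbours.  But slack₀ = 0 and slackₖ = T(n) − k·s = 0, so an
-- index j where the negative minimum over 1 ≤ j ≤ k−1 is attained lies below both.

T-closed-form : ∀ {n} m → m ≤ n → 2 * T n m + m * m ≡ m * (2 * n + 1)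
T-closed-form zero _ = refl
T-closed-form {n} (suc m) m<n = begin
    2 * (T n m + (n ∸ m)) + suc m * suc m
  ≡⟨ regroup (T n m) (n ∸ m) m ⟩
    (2 * T n m + m * m) + (2 * (n ∸ m + m) + 1)
  ≡⟨ cong₂ _+_ (T-closed-form m (<⇒≤ m<n)) (cong (λ x → 2 * x + 1) (m∸n+n≡m (<⇒≤ m<n))) ⟩
    m * (2 * n + 1) + (2 * n + 1)
  ≡⟨ +-comm _ (2 * n + 1) ⟩
    suc m * (2 * n + 1)
  ∎
  where
  open ≡-Reasoning
  regroup : ∀ t d m → 2 * (t + d) + suc m * suc m ≡ (2 * t + m * m) + (2 * (d + m) + 1)
  regroup = solve-∀

T-second-difference : ∀ {n} a q → a + q + q ≤ n →
  T n a + T n (a + q + q) + q * q ≡ T n (a + q) + T n (a + q)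
T-second-difference {n} a q a+2q≤n =
  *-cancelˡ-≡ _ _ 2 (+-cancelʳ-≡ (2 * (b * b)) _ _ (begin
      2 * (T n a + T n c + q * q) + 2 * (b * b)
    ≡⟨ squares (T n a) (T n c) a q ⟩
      (2 * T n a + a * a) + (2 * T n c + c * c)
    ≡⟨ cong₂ _+_ (T-closed-form a a≤n) (T-closed-form c a+2q≤n) ⟩
      a * N + c * N
    ≡⟨ linear a q N ⟩
      b * N + b * N
    ≡⟨ cong₂ _+_ (sym (T-closed-form b b≤n)) (sym (T-closed-form b b≤n)) ⟩
      (2 * T n b + b * b) + (2 * T n b + b * b)
    ≡⟨ doubles (T n b) (b * b) ⟩
      2 * (T n b + T n b) + 2 * (b * b)
    ∎))
  where
  open ≡-Reasoning
  N b c : ℕ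
  N = 2 * n + 1
  b = a + q
  c = a + q + q
  b≤n : b ≤ n
  b≤n = ≤-trans (m≤m+n b q) a+2q≤n
  a≤n : a ≤ n
  a≤n = ≤-trans (m≤m+n a q) b≤n
  squares : ∀ x z a q → 2 * (x + z + q * q) + 2 * ((a + q) * (a + q))
                       ≡ (2 * x + a * a) + (2 * z + (a + q + q) * (a + q + q))
  squares = solve-∀
  linear : ∀ a q N → a * N + (a + q + q) * N ≡ (a + q) * N + (a + q) * N
  linear = solve-∀
  doubles : ∀ y w → (2 * y + w) + (2 * y + w) ≡ 2 * (y + y) + 2 * w
  doubles = solve-∀

T-total : ∀ {n k s} → 2 * k * s ≡ n * (n + 1) → T n n ≡ k * s
T-total {n} {k} {s} 2ks≡n[n+1] = *-cancelˡ-≡ _ _ 2 (+-cancelʳ-≡ (n * n) _ _ (begin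
    2 * T n n + n * n   ≡⟨ T-closed-form n ≤-refl ⟩
    n * (2 * n + 1)     ≡⟨ split n ⟩
    n * (n + 1) + n * n ≡⟨ cong (_+ n * n) (trans (sym 2ks≡n[n+1]) (*-assoc 2 k s)) ⟩
    2 * (k * s) + n * n ∎))
  where
  open ≡-Reasoning
  split : ∀ n → n * (2 * n + 1) ≡ n * (n + 1) + n * n
  split = solve-∀

sum-take-suc : ∀ xs j → j < length xs → sum (take (suc j) xs) ≡ sum (take j xs) + p xs (suc j)
sum-take-suc (x ∷ xs) zero    _         = +-comm x 0
sum-take-suc (x ∷ xs) (suc j) (s≤s j<) =
  trans (cong (λ y → x + y) (sum-take-suc xs j j<)) (sym (+-assoc x _ _))

sum-take≤sum : ∀ m xs → sum (take m xs) ≤ sum xs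
sum-take≤sum m xs = subst (sum (take m xs) ≤_)
  (trans (sym (sum-++ (take m xs) (drop m xs))) (cong sum (take++drop≡id m xs)))
  (m≤m+n _ _)

p-positive : ∀ xs i → All (1 ≤_) xs → i < length xs → 1 ≤ p xs (suc i)
p-positive (x ∷ xs) zero    (1≤x ∷ _)  _        = 1≤x
p-positive (x ∷ xs) (suc i) (_ ∷ 1≤xs) (s≤s i<) = p-positive xs i 1≤xs i<

p-ascending : ∀ xs i → Linked _≤_ xs → suc i < length xs → p xs (suc i) ≤ p xs (suc (suc i))
p-ascending (x ∷ y ∷ ys) zero    (x≤y ∷ _) _         = x≤y
p-ascending (x ∷ xs)     (suc i) (_ ∷ asc) (s≤s i<) = p-ascending xs i asc i<
p-ascending (x ∷ [])     i       [-]       (s≤s ())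

module _ (n s : ℕ) (ps : List ℕ) where

  slackFrom≤head : ∀ m j₀ → slackFrom n s ps m j₀ ℤ.≤ slackAt n s ps j₀
  slackFrom≤head zero    j₀ = ℤ.≤-refl
  slackFrom≤head (suc m) j₀ = ℤ.i⊓j≤i _ _

  slackFrom≤slackAt : ∀ m j₀ d → d ≤ m → slackFrom n s ps m j₀ ℤ.≤ slackAt n s ps (j₀ + d)
  slackFrom≤slackAt m j₀ zero _ =
    subst (λ j → slackFrom n s ps m j₀ ℤ.≤ slackAt n s ps j) (sym (+-identityʳ j₀)) (slackFrom≤head m j₀)
  slackFrom≤slackAt (suc m) j₀ (suc d) (s≤s d≤m) =
    subst (λ j → slackFrom n s ps (suc m) j₀ ℤ.≤ slackAt n s ps j) (sym (+-suc j₀ d))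
      (ℤ.≤-trans (ℤ.i⊓j≤j _ _) (slackFrom≤slackAt m (suc j₀) d d≤m))

  slackFrom-attained : ∀ m j₀ → ∃[ d ] (d ≤ m × slackFrom n s ps m j₀ ≡ slackAt n s ps (j₀ + d))
  slackFrom-attained zero j₀ = 0 , z≤n , cong (slackAt n s ps) (sym (+-identityʳ j₀))
  slackFrom-attained (suc m) j₀ with ℤ.⊓-sel (slackAt n s ps j₀) (slackFrom n s ps m (suc j₀))
  ... | inj₁ min≡head = 0 , z≤n , trans min≡head (cong (slackAt n s ps) (sym (+-identityʳ j₀)))
  ... | inj₂ min≡tail with slackFrom-attained m (suc j₀)
  ...   | d , d≤m , tail≡ =
    suc d , s≤s d≤m , trans min≡tail (trans tail≡ (cong (slackAt n s ps) (sym (+-suc j₀ d))))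

slackAt-size : ∀ {n k s ps} → 2 * k * s ≡ n * (n + 1) → IsAscPartition n k ps → slackAt n s ps k ≡ + 0
slackAt-size {n} {k} {s} {ps} 2ks≡n[n+1] P
  rewrite take-all k ps (≤-reflexive (IsAscPartition.size P)) | IsAscPartition.total P
        | T-total {n} {k} {s} 2ks≡n[n+1] =
  ℤ.+-inverseʳ (+ (k * s))

slack≤slackAt : ∀ {n s ps} m → slackAt n s ps (suc (suc m)) ≡ + 0 →
  slack n s ps (suc (suc m)) ℤ.≤ + 0 → ∀ j → j ≤ suc (suc m) →
  slack n s ps (suc (suc m)) ℤ.≤ slackAt n s ps j
slack≤slackAt m σₖ≡0 slack≤0 zero _ = slack≤0
slack≤slackAt {n} {s} {ps} m σₖ≡0 slack≤0 (suc j) (s≤s j≤1+m) with m≤n⇒m<n∨m≡n j≤1+m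
... | inj₁ (s≤s j≤m) = slackFrom≤slackAt n s ps m 1 j j≤m
... | inj₂ refl      = subst (slack n s ps (suc (suc m)) ℤ.≤_) (sym σₖ≡0) slack≤0

pos-differences-midpoint : ∀ {a b c a′ b′ c′ d} → a + c + d ≡ b + b → a′ + c′ ≡ b′ + b′ →
  (+ a ℤ.- + a′) ℤ.+ (+ c ℤ.- + c′) ℤ.+ + d ≡ (+ b ℤ.- + b′) ℤ.+ (+ b ℤ.- + b′)
pos-differences-midpoint {a} {b} {c} {a′} {b′} {c′} {d} a+c+d≡2b a′+c′≡2b′ = begin
    (+ a ℤ.- + a′) ℤ.+ (+ c ℤ.- + c′) ℤ.+ + d
  ≡⟨ regroup (+ a) (+ c) (+ d) (+ a′) (+ c′) ⟩
    (+ a ℤ.+ + c ℤ.+ + d) ℤ.- (+ a′ ℤ.+ + c′)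
  ≡⟨ cong₂ ℤ._-_ (sym (trans (ℤ.pos-+ (a + c) d) (cong (ℤ._+ + d) (ℤ.pos-+ a c)))) (sym (ℤ.pos-+ a′ c′)) ⟩
    + (a + c + d) ℤ.- + (a′ + c′)
  ≡⟨ cong₂ (λ x y → + x ℤ.- + y) a+c+d≡2b a′+c′≡2b′ ⟩
    + (b + b) ℤ.- + (b′ + b′)
  ≡⟨ cong₂ ℤ._-_ (ℤ.pos-+ b b) (ℤ.pos-+ b′ b′) ⟩
    (+ b ℤ.+ + b) ℤ.- (+ b′ ℤ.+ + b′)
  ≡⟨ ungroup (+ b) (+ b′) ⟩
    (+ b ℤ.- + b′) ℤ.+ (+ b ℤ.- + b′)
  ∎
  where
  open ≡-Reasoning
  regroup : ∀ a c d a′ c′ → (a ℤ.- a′) ℤ.+ (c ℤ.- c′) ℤ.+ d ≡ (a ℤ.+ c ℤ.+ d) ℤ.- (a′ ℤ.+ c′)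
  regroup = ℤ-Solver.solve-∀
  ungroup : ∀ b b′ → (b ℤ.+ b) ℤ.- (b′ ℤ.+ b′) ≡ (b ℤ.- b′) ℤ.+ (b ℤ.- b′)
  ungroup = ℤ-Solver.solve-∀

slackAt-second-difference : ∀ {n s ps i q} →
  sum (take (suc i) ps) ≡ sum (take i ps) + q →
  sum (take (suc (suc i)) ps) ≡ sum (take i ps) + q + q →
  sum (take i ps) + q + q ≤ n →
  slackAt n s ps i ℤ.+ slackAt n s ps (suc (suc i)) ℤ.+ + (q * q)
    ≡ slackAt n s ps (suc i) ℤ.+ slackAt n s ps (suc i)
slackAt-second-difference {n} {s} {ps} {i} {q} Sᵢ₊₁≡ Sᵢ₊₂≡ Sᵢ₊₂≤n rewrite Sᵢ₊₁≡ | Sᵢ₊₂≡ =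
  pos-differences-midpoint {a′ = i * s} {suc i * s} {suc (suc i) * s} (T-second-difference (sum (take i ps)) q Sᵢ₊₂≤n) (multiples i s)
  where
  multiples : ∀ i s → i * s + suc (suc i) * s ≡ suc i * s + suc i * s
  multiples = solve-∀

slackAt-second-difference-at-repeat : ∀ {n k s ps i} → IsAscPartition n k ps → suc i < k →
  p ps (suc (suc i)) ≡ p ps (suc i) →
  slackAt n s ps i ℤ.+ slackAt n s ps (suc (suc i)) ℤ.+ + (p ps (suc i) * p ps (suc i))
    ≡ slackAt n s ps (suc i) ℤ.+ slackAt n s ps (suc i)
slackAt-second-difference-at-repeat {n} {k} {s} {ps} {i} P 1+i<k pᵢ₊₂≡pᵢ₊₁ =
  slackAt-second-difference {n} {s} {ps} {i} Sᵢ₊₁≡ Sᵢ₊₂≡ (subst₂ _≤_ Sᵢ₊₂≡ total (sum-take≤sum (suc (suc i)) ps))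
  where
  open IsAscPartition P
  1+i<len : suc i < length ps
  1+i<len = subst (suc i <_) (sym size) 1+i<k
  Sᵢ₊₁≡ : sum (take (suc i) ps) ≡ sum (take i ps) + p ps (suc i)
  Sᵢ₊₁≡ = sum-take-suc ps i (<⇒≤ 1+i<len)
  Sᵢ₊₂≡ : sum (take (suc (suc i)) ps) ≡ sum (take i ps) + p ps (suc i) + p ps (suc i)
  Sᵢ₊₂≡ = trans (sum-take-suc ps (suc i) 1+i<len) (cong₂ _+_ Sᵢ₊₁≡ pᵢ₊₂≡pᵢ₊₁)

¬-local-min-of-strictly-concave : ∀ {x y z c} → x ℤ.+ z ℤ.+ c ≡ y ℤ.+ y → + 0 <ℤ c →
  y ℤ.≤ x → y ℤ.≤ z → ⊥
¬-local-min-of-strictly-concave {x} {y} {z} {c} x+z+c≡2y 0<c y≤x y≤z =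
  ℤ.<-irrefl refl (ℤ.≤-<-trans (ℤ.+-mono-≤ y≤x y≤z) (begin-strict
    x ℤ.+ z          ≡⟨ sym (ℤ.+-identityʳ (x ℤ.+ z)) ⟩
    x ℤ.+ z ℤ.+ + 0  <⟨ ℤ.+-monoʳ-< (x ℤ.+ z) 0<c ⟩
    x ℤ.+ z ℤ.+ c    ≡⟨ x+z+c≡2y ⟩
    y ℤ.+ y          ∎))
  where open ℤ.≤-Reasoning

lemma6p4 : (n k s : ℕ) → 1 ≤ n → 2 ≤ k → 2 * k * s ≡ n * (n + 1) →
    (ps : List ℕ) → IsAscPartition n k ps →
    slack n s ps k <ℤ + 0 →
    Σ ℕ (λ j → (1 ≤ j × j < k) × (p ps j < p ps (j + 1) × slack n s ps k ≡ slackAt n s ps j))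
lemma6p4 n (suc (suc m)) s _ (s≤s (s≤s z≤n)) 2ks≡n[n+1] ps P slack<0
  with slackFrom-attained n s ps m 1
... | i , i≤m , slack≡σᵢ₊₁ with p ps (suc i) <? p ps (suc (suc i))
...   | yes pᵢ₊₁<pᵢ₊₂ =
  suc i , (s≤s z≤n , s≤s (s≤s i≤m)) ,
  subst (λ j → p ps (suc i) < p ps j) (cong suc (+-comm 1 i)) pᵢ₊₁<pᵢ₊₂ , slack≡σᵢ₊₁
...   | no pᵢ₊₁≮pᵢ₊₂ = ⊥-elim (¬-local-min-of-strictly-concave
  (slackAt-second-difference-at-repeat P 1+i<k pᵢ₊₂≡pᵢ₊₁) (ℤ.+<+ (*-mono-≤ 1≤pᵢ₊₁ 1≤pᵢ₊₁))
  (below i (m≤n⇒m≤1+n (m≤n⇒m≤1+n i≤m))) (below (suc (suc i)) 1+i<k))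
  where
  open IsAscPartition P
  1+i<k : suc i < suc (suc m)
  1+i<k = s≤s (s≤s i≤m)
  1≤pᵢ₊₁ : 1 ≤ p ps (suc i)
  1≤pᵢ₊₁ = p-positive ps i positive (subst (i <_) (sym size) (<⇒≤ 1+i<k))
  pᵢ₊₂≡pᵢ₊₁ : p ps (suc (suc i)) ≡ p ps (suc i)
  pᵢ₊₂≡pᵢ₊₁ = ≤-antisym (≮⇒≥ pᵢ₊₁≮pᵢ₊₂) (p-ascending ps i ascending (subst (suc i <_) (sym size) 1+i<k))
  below : ∀ j → j ≤ suc (suc m) → slackAt n s ps (suc i) ℤ.≤ slackAt n s ps j
  below j j≤k = subst (ℤ._≤ slackAt n s ps j) slack≡σᵢ₊₁
    (slack≤slackAt m (slackAt-size {s = s} 2ks≡n[n+1] P) (ℤ.<⇒≤ slack<0) j j≤k)
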